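{- Let $q$ be a natural number that is not a perfect square. Then there exists $a\in L$ with $a^2=q$ if and only if $q=2^{2\ell}5^{2k}q'$ for some $k,\ell\in\mathbb{N}_0$ and some natural number $q'$ with $\gcd(q',10)=1$ and $q'\equiv 1 \pmod{40}$ or $q'\equiv 9\pmod{40}$.
   Context: $L$ denotes the ring of $10$-adic integers: its elements are infinite digit sequences $a=\ldots a_3a_2a_1$ with $a_i\in\{0,1,\ldots,9\}$, written from right to left, with addition and multiplication defined by the usual school algorithms where carries propagate indefinitely to the left. Equivalently, $L=\varprojlim \mathbb{Z}/10^n\mathbb{Z}$. A natural number $m$ is identified with the element $\ldots 000 m$ of $L$. -}

module Defs where

open import Data.Nat using (ℕ; zero; suc; _+_; _*_; _^_; _<_; NonZero)
open import Data.Nat.DivMod using (_%_)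
open import Data.Nat.GCD using (gcd)
open import Relation.Binary.PropositionalEquality using (_≡_)


open import Data.Nat.Properties using (m^n≢0)
open import Data.Product using (Σ)

_mod10^_ : ℕ → ℕ → ℕ
m mod10^ n = _%_ m (10 ^ n) {{m^n≢0 10 n}}

-- The ring L of 10-adic integers as the inverse limit  lim Z/10^n Z :
-- an element is a compatible sequence of residues  x n ∈ {0,…,10^n - 1}.
record L : Set where
  constructor mkL
  field
    res   : ℕ → ℕ
    bounded  : ∀ n → res n < 10 ^ n
    coherent : ∀ n → res (suc n) mod10^ n ≡ res n
open L public

_≈L_ : L → L → Set
a ≈L b = ∀ n → res a n ≡ res b n

-- multiplication in the inverse limit: componentwise in Z/10^n Z
-- (given as the residue sequence; coherence is a standard fact)
mulAt : L → L → ℕ → ℕ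
mulAt a b n = (res a n * res b n) mod10^ n

natAt : ℕ → ℕ → ℕ
natAt m n = m mod10^ n

SquareEq : L → ℕ → Set
SquareEq a m = ∀ n → mulAt a a n ≡ natAt m n

IsPerfectSquare : ℕ → Set
IsPerfectSquare q = Σ ℕ λ r → r * r ≡ q

-- A 10-adic root of q is the same thing as a coherent choice of square roots of q modulo all
-- powers of 10.  Necessity: write q = 2^α 5^β u with u prime to 10 and take a root x of q modulo a
-- power of 10 divisible by 2^(α+3) 5^(β+1).  A square congruent to p^α v (p ∤ v) modulo p^(α+1)
-- forces α to be even and p^(α/2) ∣ x; cancelling these factors for p = 2 and p = 5 leaves
-- z² ≡ u (mod 40), and the only squares modulo 40 prime to 10 are 1 and 9.  Sufficiency: 1 or 3
-- is a root of u modulo 40, and by Hensel's lemma a root s of u modulo 40·10ⁿ lifts to a root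
-- s + 10ⁿ⁺¹ t modulo 40·10ⁿ⁺¹; then 2^l 5^k s is a coherent sequence of roots of q = 2^2l 5^2k u.
module Submission where

open import Defs
open import Data.Nat using (ℕ; _*_; _^_)
open import Data.Nat.DivMod using (_%_)
open import Data.Nat.GCD using (gcd)
open import Data.Product using (Σ; ∃; _×_)
open import Data.Sum using (_⊎_)
open import Function.Bundles using (_⇔_)
open import Relation.Nullary using (¬_)
open import Relation.Binary.PropositionalEquality using (_≡_)

open import Data.Empty using (⊥-elim)
open import Data.List using ([]; _∷_)
open import Data.Nat using (zero; suc; _+_; _<_; NonZero; ≢-nonZero; z≤n; s≤s)
open import Data.Nat.Divisibility
  using (_∣_; divides; _∣?_; ∣-trans; ∣-refl; 1∣_; m∣m*n; n∣m*n; ∣n⇒∣m*n; ∣m∣n⇒∣m+n;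
         ∣m+n∣m⇒∣n; *-pres-∣; *-monoˡ-∣; *-monoʳ-∣; *-cancelˡ-∣; ∣⇒≤)
open import Data.Nat.DivMod using (_/_; m≡m%n+[m/n]*n; [m+kn]%n≡m%n; m%n<n; m∣n⇒o%n%m≡o%m)
open import Data.Nat.GCD using (gcd[m,n]∣m; gcd[m,n]∣n)
open import Data.Nat.Induction using (<-rec)
open import Data.Nat.Primality using (Prime; prime?; prime[2]; euclidsLemma; prime⇒nonZero)
open import Data.Nat.Properties
  using (_≟_; +-comm; +-suc; +-identityʳ; *-comm; *-assoc; +-cancelʳ-≡; *-cancelˡ-≡;
         [m*n]*[o*p]≡[m*o]*[n*p]; ^-distribˡ-+-*; m^n≢0; m<m*n; anyUpTo?; allUpTo?)
open import Data.Nat.Tactic.RingSolver using (solve)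
open import Data.Product using (∃₂; _,_; proj₁; proj₂)
open import Data.Sum using (inj₁; inj₂; [_,_]′)
open import Function using (_∘_; id; flip)
open import Function.Bundles using (mk⇔)
open import Level using (0ℓ)
open import Relation.Binary.Bundles using (Setoid)
open import Relation.Binary.Structures using (IsEquivalence)
open import Relation.Binary.PropositionalEquality
  using (_≢_; refl; sym; trans; cong; cong₂; subst; subst₂; module ≡-Reasoning)
open import Relation.Nullary using (¬?; yes; no)
open import Relation.Nullary.Decidable using (from-yes; _→-dec_; _⊎-dec_)
import Relation.Binary.Reasoning.Setoid as SetoidReasoning

-- Congruence modulo m

-- Stated without _%_, so that it makes sense for every modulus and its algebra needs no NonZero
-- instances.
infix 4 _≡_mod_
record _≡_mod_ (a b m : ℕ) : Set where
  constructor ≡-mod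
  field
    i j : ℕ
    balance : a + i * m ≡ b + j * m

module _ {m : ℕ} where

  ≡-mod-reflexive : ∀ {a b} → a ≡ b → a ≡ b mod m
  ≡-mod-reflexive refl = ≡-mod 0 0 refl

  ≡-mod-sym : ∀ {a b} → a ≡ b mod m → b ≡ a mod m
  ≡-mod-sym (≡-mod i j e) = ≡-mod j i (sym e)

  ≡-mod-trans : ∀ {a b c} → a ≡ b mod m → b ≡ c mod m → a ≡ c mod m
  ≡-mod-trans {a} {b} {c} (≡-mod i j e) (≡-mod k l f) = ≡-mod (i + k) (l + j) (begin
    a + (i + k) * m    ≡⟨ solve (a ∷ i ∷ k ∷ m ∷ []) ⟩
    a + i * m + k * m  ≡⟨ cong (_+ k * m) e ⟩
    b + j * m + k * m  ≡⟨ solve (b ∷ j ∷ k ∷ m ∷ []) ⟩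
    b + k * m + j * m  ≡⟨ cong (_+ j * m) f ⟩
    c + l * m + j * m  ≡⟨ solve (c ∷ l ∷ j ∷ m ∷ []) ⟩
    c + (l + j) * m    ∎)
    where open ≡-Reasoning

  ≡-mod-isEquivalence : IsEquivalence (λ a b → a ≡ b mod m)
  ≡-mod-isEquivalence = record
    { refl = ≡-mod-reflexive refl ; sym = ≡-mod-sym ; trans = ≡-mod-trans }

≡-mod-setoid : ℕ → Setoid 0ℓ 0ℓ
≡-mod-setoid m = record { isEquivalence = ≡-mod-isEquivalence {m} }

module ≡-mod-Reasoning (m : ℕ) = SetoidReasoning (≡-mod-setoid m)

module _ {m : ℕ} where

  +-cong-mod : ∀ {a b c d} → a ≡ b mod m → c ≡ d mod m → a + c ≡ b + d mod m
  +-cong-mod {a} {b} {c} {d} (≡-mod i j e) (≡-mod k l f) = ≡-mod (i + k) (j + l) (begin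
    a + c + (i + k) * m          ≡⟨ solve (a ∷ c ∷ i ∷ k ∷ m ∷ []) ⟩
    (a + i * m) + (c + k * m)    ≡⟨ cong₂ _+_ e f ⟩
    (b + j * m) + (d + l * m)    ≡⟨ solve (b ∷ d ∷ j ∷ l ∷ m ∷ []) ⟩
    b + d + (j + l) * m          ∎)
    where open ≡-Reasoning

  *-congˡ-mod : ∀ {a b} c → a ≡ b mod m → c * a ≡ c * b mod m
  *-congˡ-mod {a} {b} c (≡-mod i j e) = ≡-mod (c * i) (c * j) (begin
    c * a + c * i * m  ≡⟨ solve (c ∷ a ∷ i ∷ m ∷ []) ⟩
    c * (a + i * m)    ≡⟨ cong (c *_) e ⟩
    c * (b + j * m)    ≡⟨ solve (c ∷ b ∷ j ∷ m ∷ []) ⟩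
    c * b + c * j * m  ∎)
    where open ≡-Reasoning

  *-congʳ-mod : ∀ {a b} c → a ≡ b mod m → a * c ≡ b * c mod m
  *-congʳ-mod {a} {b} c a≡b =
    subst₂ (λ x y → x ≡ y mod m) (*-comm c a) (*-comm c b) (*-congˡ-mod c a≡b)

  *-cong-mod : ∀ {a b c d} → a ≡ b mod m → c ≡ d mod m → a * c ≡ b * d mod m
  *-cong-mod {b = b} {c} a≡b c≡d = ≡-mod-trans (*-congʳ-mod c a≡b) (*-congˡ-mod b c≡d)

  +-multiple-mod : ∀ {a} k → a + m * k ≡ a mod m
  +-multiple-mod {a} k = ≡-mod 0 k (trans (+-identityʳ _) (cong (a +_) (*-comm m k)))

  ≡-mod-∣ : ∀ {a b d} → d ∣ m → a ≡ b mod m → a ≡ b mod d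
  ≡-mod-∣ {a} {b} {d} (divides e refl) (≡-mod i j f) = ≡-mod (i * e) (j * e)
    (trans (cong (a +_) (*-assoc i e d)) (trans f (cong (b +_) (sym (*-assoc j e d)))))

  ∣-resp-≡-mod : ∀ {a b d} → d ∣ m → a ≡ b mod m → d ∣ b → d ∣ a
  ∣-resp-≡-mod {a} {b} {d} d∣m (≡-mod i j e) d∣b = ∣m+n∣m⇒∣n d∣i*m+a (∣-trans d∣m (n∣m*n i))
    where
    d∣i*m+a : d ∣ i * m + a
    d∣i*m+a = subst (d ∣_) (trans (sym e) (+-comm a (i * m)))
                           (∣m∣n⇒∣m+n d∣b (∣-trans d∣m (n∣m*n j)))

  *-scale-mod : ∀ {a b} c → a ≡ b mod m → c * a ≡ c * b mod c * m
  *-scale-mod {a} {b} c (≡-mod i j e) = ≡-mod i j (begin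
    c * a + i * (c * m)  ≡⟨ solve (c ∷ a ∷ i ∷ m ∷ []) ⟩
    c * (a + i * m)      ≡⟨ cong (c *_) e ⟩
    c * (b + j * m)      ≡⟨ solve (c ∷ b ∷ j ∷ m ∷ []) ⟩
    c * b + j * (c * m)  ∎)
    where open ≡-Reasoning

  *-cancel-mod : ∀ {a b} c .{{_ : NonZero c}} → c * a ≡ c * b mod c * m → a ≡ b mod m
  *-cancel-mod {a} {b} c (≡-mod i j e) = ≡-mod i j (*-cancelˡ-≡ _ _ c (begin
    c * (a + i * m)      ≡⟨ solve (c ∷ a ∷ i ∷ m ∷ []) ⟩
    c * a + i * (c * m)  ≡⟨ e ⟩
    c * b + j * (c * m)  ≡⟨ solve (c ∷ b ∷ j ∷ m ∷ []) ⟩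
    c * (b + j * m)      ∎))
    where open ≡-Reasoning

  module _ .{{_ : NonZero m}} where

    %-≡-mod : ∀ a → a % m ≡ a mod m
    %-≡-mod a = ≡-mod (a / m) 0 (trans (sym (m≡m%n+[m/n]*n a m)) (sym (+-identityʳ a)))

    ≡-mod⇒%-≡ : ∀ {a b} → a ≡ b mod m → a % m ≡ b % m
    ≡-mod⇒%-≡ {a} {b} (≡-mod i j e) =
      trans (sym ([m+kn]%n≡m%n a i m)) (trans (cong (_% m) e) ([m+kn]%n≡m%n b j m))

    %-≡⇒≡-mod : ∀ {a b} → a % m ≡ b % m → a ≡ b mod m
    %-≡⇒≡-mod {a} {b} e =
      ≡-mod-trans (≡-mod-sym (%-≡-mod a)) (≡-mod-trans (≡-mod-reflexive e) (%-≡-mod b))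

-- Squares modulo prime powers

^-double : ∀ p l → p ^ (2 * l) ≡ p ^ l * p ^ l
^-double p l = trans (cong (λ e → p ^ (l + e)) (+-identityʳ l)) (^-distribˡ-+-* p l l)

y*p^l*[y*p^l]≡p^[2l]*[y*y] : ∀ p l y → y * p ^ l * (y * p ^ l) ≡ p ^ (2 * l) * (y * y)
y*p^l*[y*p^l]≡p^[2l]*[y*y] p l y = begin
  y * p ^ l * (y * p ^ l)      ≡⟨ [m*n]*[o*p]≡[m*o]*[n*p] y (p ^ l) y (p ^ l) ⟩
  y * y * (p ^ l * p ^ l)      ≡⟨ *-comm (y * y) _ ⟩
  p ^ l * p ^ l * (y * y)      ≡⟨ cong (_* (y * y)) (^-double p l) ⟨
  p ^ (2 * l) * (y * y)        ∎
  where open ≡-Reasoning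

even-or-odd : ∀ n → ∃ λ l → n ≡ 2 * l ⊎ n ≡ suc (2 * l)
even-or-odd zero = 0 , inj₁ refl
even-or-odd (suc n) with even-or-odd n
... | l , inj₁ refl = l , inj₂ refl
... | l , inj₂ refl = suc l , inj₁ (cong suc (sym (+-suc l (l + 0))))

module _ {p : ℕ} (p-prime : Prime p) where

  private instance
    p≢0 : NonZero p
    p≢0 = prime⇒nonZero p-prime

  p∣x*x⇒p∣x : ∀ {x} → p ∣ x * x → p ∣ x
  p∣x*x⇒p∣x {x} p∣x*x = [ id , id ]′ (euclidsLemma x x p-prime p∣x*x)

  p^[2l]∣x*x⇒p^l∣x : ∀ l {x} → p ^ (2 * l) ∣ x * x → p ^ l ∣ x
  p^[1+2l]∣x*x⇒p^[1+l]∣x : ∀ l {x} → p ^ suc (2 * l) ∣ x * x → p ^ suc l ∣ x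

  p^[2l]∣x*x⇒p^l∣x zero _ = 1∣ _
  p^[2l]∣x*x⇒p^l∣x (suc l) p^[2+2l]∣x*x =
    p^[1+2l]∣x*x⇒p^[1+l]∣x l (∣-trans p^[1+2l]∣p^[2+2l] p^[2+2l]∣x*x)
    where
    p^[1+2l]∣p^[2+2l] : p ^ suc (2 * l) ∣ p ^ (2 * suc l)
    p^[1+2l]∣p^[2+2l] = subst (λ e → p ^ suc (2 * l) ∣ p * p ^ e) (sym (+-suc l (l + 0))) (n∣m*n p)

  p^[1+2l]∣x*x⇒p^[1+l]∣x l {x} p^[1+2l]∣x*x
    with p^[2l]∣x*x⇒p^l∣x l {x} (∣-trans (n∣m*n p) p^[1+2l]∣x*x)
  ... | divides y refl =
    *-monoˡ-∣ (p ^ l)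
      (p∣x*x⇒p∣x {y} (*-cancelˡ-∣ (p ^ (2 * l)) {{m^n≢0 p (2 * l)}} p^[2l]*p∣p^[2l]*y*y))
    where
    p^[2l]*p∣p^[2l]*y*y : p ^ (2 * l) * p ∣ p ^ (2 * l) * (y * y)
    p^[2l]*p∣p^[2l]*y*y = subst₂ _∣_ (*-comm p _) (y*p^l*[y*p^l]≡p^[2l]*[y*y] p l y) p^[1+2l]∣x*x

  cancel-even-power-square : ∀ l {v m x} → x * x ≡ p ^ (2 * l) * v mod p ^ (2 * l) * m →
                             ∃ λ y → y * y ≡ v mod m
  cancel-even-power-square l {v} {m} {x} x*x≡
    with p^[2l]∣x*x⇒p^l∣x l {x} (∣-resp-≡-mod (m∣m*n m) x*x≡ (m∣m*n v))
  ... | divides y refl = y , *-cancel-mod (p ^ (2 * l)) {{m^n≢0 p (2 * l)}}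
          (subst (_≡ p ^ (2 * l) * v mod p ^ (2 * l) * m) (y*p^l*[y*p^l]≡p^[2l]*[y*y] p l y) x*x≡)

  no-odd-power-square : ∀ l {v m x} → ¬ p ∣ v → p ∣ m →
                        ¬ (x * x ≡ p ^ suc (2 * l) * v mod p ^ suc (2 * l) * m)
  no-odd-power-square l {v} {m} {x} p∤v p∣m x*x≡ =
    p∤v (*-cancelˡ-∣ (p ^ α) {{m^n≢0 p α}} (∣-resp-≡-mod ∣-refl (≡-mod-sym x*x≡′) p^α*p∣x*x))
    where
    α = suc (2 * l)
    x*x≡′ : x * x ≡ p ^ α * v mod p ^ α * p
    x*x≡′ = ≡-mod-∣ (*-monoʳ-∣ (p ^ α) p∣m) x*x≡
    p^[1+l]∣x : p ^ suc l ∣ x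
    p^[1+l]∣x = p^[1+2l]∣x*x⇒p^[1+l]∣x l (∣-resp-≡-mod (m∣m*n p) x*x≡′ (m∣m*n v))
    p^[1+l]*p^[1+l]≡p^α*p : p ^ suc l * p ^ suc l ≡ p ^ α * p
    p^[1+l]*p^[1+l]≡p^α*p = trans (sym (^-double p (suc l)))
      (trans (cong (λ e → p * p ^ e) (+-suc l (l + 0))) (*-comm p _))
    p^α*p∣x*x : p ^ α * p ∣ x * x
    p^α*p∣x*x = subst (_∣ x * x) p^[1+l]*p^[1+l]≡p^α*p (*-pres-∣ p^[1+l]∣x p^[1+l]∣x)

  peel-square : ∀ {v m α x} → ¬ p ∣ v → p ∣ m → x * x ≡ p ^ α * v mod p ^ α * m →
                ∃₂ λ l y → α ≡ 2 * l × (y * y ≡ v mod m)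
  peel-square {α = α} {x} p∤v p∣m x*x≡ with even-or-odd α
  ... | l , inj₁ refl =
    let y , y*y≡v = cancel-even-power-square l {x = x} x*x≡ in l , y , refl , y*y≡v
  ... | l , inj₂ refl = ⊥-elim (no-odd-power-square l {x = x} p∤v p∣m x*x≡)

-- Necessity of the criterion

SquareCriterion : ℕ → Set
SquareCriterion q = Σ ℕ λ k → Σ ℕ λ l → Σ ℕ λ q′ →
  (q ≡ 2 ^ (2 * l) * 5 ^ (2 * k) * q′) × (gcd q′ 10 ≡ 1) × ((q′ % 40 ≡ 1) ⊎ (q′ % 40 ≡ 9))

factor-out-power : ∀ {p} → 1 < p → ∀ n → n ≢ 0 → ∃₂ λ α v → n ≡ p ^ α * v × ¬ p ∣ v
factor-out-power {p} 1<p = <-rec P factor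
  where
  P : ℕ → Set
  P n = n ≢ 0 → ∃₂ λ α v → n ≡ p ^ α * v × ¬ p ∣ v
  factor : ∀ n → (∀ {m} → m < n → P m) → P n
  factor n rec n≢0 with p ∣? n
  ... | no p∤n = 0 , n , sym (+-identityʳ n) , p∤n
  ... | yes (divides m refl) =
    let α , v , m≡p^α*v , p∤v = rec (m<m*n m p {{≢-nonZero m≢0}} 1<p) m≢0
    in suc α , v , trans (cong (_* p) m≡p^α*v) (trans (*-comm _ p) (sym (*-assoc p _ v))) , p∤v
    where
    m≢0 : m ≢ 0
    m≢0 refl = n≢0 refl

square-mod-40 : ∀ {u x} → ¬ 2 ∣ u → ¬ 5 ∣ u → x * x ≡ u mod 40 → u % 40 ≡ 1 ⊎ u % 40 ≡ 9
square-mod-40 {u} {x} 2∤u 5∤u x*x≡u = subst (λ s → s ≡ 1 ⊎ s ≡ 9) r*r≡u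
  (table (m%n<n x 40) (2∤u ∘ ∣r*r⇒∣u (divides 20 refl)) (5∤u ∘ ∣r*r⇒∣u (divides 8 refl)))
  where
  table : ∀ {r} → r < 40 → ¬ 2 ∣ (r * r) % 40 → ¬ 5 ∣ (r * r) % 40 →
          (r * r) % 40 ≡ 1 ⊎ (r * r) % 40 ≡ 9
  table = from-yes (allUpTo? (λ r → ¬? (2 ∣? ((r * r) % 40)) →-dec ¬? (5 ∣? ((r * r) % 40)) →-dec
                                     ((r * r) % 40 ≟ 1 ⊎-dec (r * r) % 40 ≟ 9)) 40)
  r*r≡u : (x % 40 * (x % 40)) % 40 ≡ u % 40
  r*r≡u = ≡-mod⇒%-≡ (≡-mod-trans (*-cong-mod (%-≡-mod x) (%-≡-mod x)) x*x≡u)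
  ∣r*r⇒∣u : ∀ {d} → d ∣ 40 → d ∣ (x % 40 * (x % 40)) % 40 → d ∣ u
  ∣r*r⇒∣u {d} d∣40 = ∣-resp-≡-mod d∣40 (≡-mod-sym (%-≡-mod u)) ∘ subst (d ∣_) r*r≡u

gcd[u,10]≡1 : ∀ {u} → ¬ 2 ∣ u → ¬ 5 ∣ u → gcd u 10 ≡ 1
gcd[u,10]≡1 {u} 2∤u 5∤u =
  table (s≤s (∣⇒≤ d∣10)) d∣10 (2∤u ∘ flip ∣-trans d∣u) (5∤u ∘ flip ∣-trans d∣u)
  where
  d∣10 : gcd u 10 ∣ 10
  d∣10 = gcd[m,n]∣n u 10
  d∣u : gcd u 10 ∣ u
  d∣u = gcd[m,n]∣m u 10
  table : ∀ {d} → d < 11 → d ∣ 10 → ¬ 2 ∣ d → ¬ 5 ∣ d → d ≡ 1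
  table = from-yes (allUpTo? (λ d → d ∣? 10 →-dec ¬? (2 ∣? d) →-dec ¬? (5 ∣? d) →-dec d ≟ 1) 11)

^-distribʳ-* : ∀ m n k → (m * n) ^ k ≡ m ^ k * n ^ k
^-distribʳ-* m n zero = refl
^-distribʳ-* m n (suc k) =
  trans (cong (m * n *_) (^-distribʳ-* m n k)) ([m*n]*[o*p]≡[m*o]*[n*p] m n _ _)

2^α*[5^β*40]∣10^[α+[β+3]] : ∀ α β → 2 ^ α * (5 ^ β * 40) ∣ 10 ^ (α + (β + 3))
2^α*[5^β*40]∣10^[α+[β+3]] α β = subst (2 ^ α * (5 ^ β * 40) ∣_) (sym 10^[α+[β+3]]≡)
  (*-pres-∣ (p^k∣[p*n]^k 2 5 α) (*-pres-∣ (p^k∣[p*n]^k 5 2 β) (divides 25 refl)))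
  where
  p^k∣[p*n]^k : ∀ p n k → p ^ k ∣ (p * n) ^ k
  p^k∣[p*n]^k p n k = subst (p ^ k ∣_) (sym (^-distribʳ-* p n k)) (m∣m*n (n ^ k))
  10^[α+[β+3]]≡ : 10 ^ (α + (β + 3)) ≡ (2 * 5) ^ α * ((5 * 2) ^ β * 10 ^ 3)
  10^[α+[β+3]]≡ =
    trans (^-distribˡ-+-* 10 α (β + 3)) (cong (10 ^ α *_) (^-distribˡ-+-* 10 β 3))

prime[5] : Prime 5
prime[5] = from-yes (prime? 5)

criterion-from-factors : ∀ {α β u x} → ¬ 2 ∣ 5 ^ β * u → ¬ 5 ∣ u →
  x * x ≡ 2 ^ α * (5 ^ β * u) mod 2 ^ α * (5 ^ β * 40) → SquareCriterion (2 ^ α * (5 ^ β * u))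
criterion-from-factors {α} {β} {u} {x} 2∤5^β*u 5∤u x*x≡
  with peel-square prime[2] {α = α} {x} 2∤5^β*u (∣n⇒∣m*n (5 ^ β) (divides 20 refl)) x*x≡
... | l , y , refl , y*y≡5^β*u with peel-square prime[5] {α = β} {y} 5∤u (divides 8 refl) y*y≡5^β*u
... | k , z , refl , z*z≡u =
  k , l , u , sym (*-assoc (2 ^ (2 * l)) (5 ^ (2 * k)) u) ,
  gcd[u,10]≡1 2∤u 5∤u , square-mod-40 {x = z} 2∤u 5∤u z*z≡u
  where
  2∤u : ¬ 2 ∣ u
  2∤u = 2∤5^β*u ∘ ∣n⇒∣m*n (5 ^ β)

square-mod-10^n⇒criterion : ∀ {q} → q ≢ 0 → (∀ n → ∃ λ x → x * x ≡ q mod 10 ^ n) →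
                            SquareCriterion q
square-mod-10^n⇒criterion {q} q≢0 root with factor-out-power {2} (s≤s (s≤s z≤n)) q q≢0
... | α , u₁ , refl , 2∤u₁ with factor-out-power {5} (s≤s (s≤s z≤n)) u₁ (2∤u₁ ∘ 2∣0)
  where
  2∣0 : u₁ ≡ 0 → 2 ∣ u₁
  2∣0 refl = divides 0 refl
... | β , u , refl , 5∤u =
  let x , x*x≡q = root (α + (β + 3))
  in  criterion-from-factors {α} {β} {u} {x} 2∤u₁ 5∤u
        (≡-mod-∣ (2^α*[5^β*40]∣10^[α+[β+3]] α β) x*x≡q)

-- 10-adic integers as coherent sequences of residues

SquareEq⇒square-mod-10^n : ∀ {a q} → SquareEq a q → ∀ n → ∃ λ x → x * x ≡ q mod 10 ^ n
SquareEq⇒square-mod-10^n {a} sq n = res a n , %-≡⇒≡-mod {{m^n≢0 10 n}} (sq n)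

fromCoherent : (x : ℕ → ℕ) → (∀ n → x (suc n) ≡ x n mod 10 ^ n) → L
fromCoherent x coh = mkL (λ n → x n mod10^ n) (λ n → m%n<n (x n) (10 ^ n) {{m^n≢0 10 n}}) res-coherent
  where
  res-coherent : ∀ n → (x (suc n) mod10^ suc n) mod10^ n ≡ x n mod10^ n
  res-coherent n =
    trans (m∣n⇒o%n%m≡o%m (10 ^ n) (10 ^ suc n) (x (suc n)) (n∣m*n 10)) (≡-mod⇒%-≡ (coh n))
    where
    instance
      10^n≢0 : NonZero (10 ^ n)
      10^n≢0 = m^n≢0 10 n
      10^[1+n]≢0 : NonZero (10 ^ suc n)
      10^[1+n]≢0 = m^n≢0 10 (suc n)

fromCoherent-square : ∀ {q} x coh → (∀ n → x n * x n ≡ q mod 10 ^ n) →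
                      SquareEq (fromCoherent x coh) q
fromCoherent-square x coh x*x≡q n =
  ≡-mod⇒%-≡ (≡-mod-trans (*-cong-mod (%-≡-mod (x n)) (%-≡-mod (x n))) (x*x≡q n))
  where
  instance
    10^n≢0 : NonZero (10 ^ n)
    10^n≢0 = m^n≢0 10 n

-- Sufficiency of the criterion: Hensel lifting

EndsIn1or3 : ℕ → Set
EndsIn1or3 s = s % 10 ≡ 1 ⊎ s % 10 ≡ 3

EndsIn1or3-resp : ∀ {a b} → a ≡ b mod 10 → EndsIn1or3 a → EndsIn1or3 b
EndsIn1or3-resp a≡b = subst (λ r → r ≡ 1 ⊎ r ≡ 3) (≡-mod⇒%-≡ a≡b)

-- The precision 40·10ⁿ is four times that of the digit added next: the extra factor 4 absorbs
-- the 2 in the derivative 2s of s².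
RootApprox : ℕ → ℕ → ℕ → Set
RootApprox u n s = (s * s ≡ u mod 40 * 10 ^ n) × EndsIn1or3 s

-- The equation (s + Pt)² − u = P·(4(j − i) + 2st + Pt²), with all subtractions moved across.
square-lift : ∀ {s u i j P t} → s * s + i * (4 * P) ≡ u + j * (4 * P) →
              4 * j + 2 * s * t + P * (t * t) ≡ 4 * i mod 40 →
              (s + P * t) * (s + P * t) ≡ u mod 40 * P
square-lift {s} {u} {i} {j} {P} {t} e (≡-mod a b f) =
  ≡-mod a b (+-cancelʳ-≡ (i * (4 * P)) _ _ (begin
  (s + P * t) * (s + P * t) + a * (40 * P) + i * (4 * P)
    ≡⟨ solve (s ∷ i ∷ a ∷ P ∷ t ∷ []) ⟩
  s * s + i * (4 * P) + P * (2 * s * t + P * (t * t) + a * 40)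
    ≡⟨ cong (_+ P * (2 * s * t + P * (t * t) + a * 40)) e ⟩
  u + j * (4 * P) + P * (2 * s * t + P * (t * t) + a * 40)
    ≡⟨ solve (u ∷ j ∷ s ∷ a ∷ P ∷ t ∷ []) ⟩
  u + P * (4 * j + 2 * s * t + P * (t * t) + a * 40)
    ≡⟨ cong (λ z → u + P * z) f ⟩
  u + P * (4 * i + b * 40)
    ≡⟨ solve (u ∷ i ∷ b ∷ P ∷ []) ⟩
  u + b * (40 * P) + i * (4 * P)  ∎))
  where open ≡-Reasoning

-- Only j mod 10, i mod 10, s mod 20 and P mod 40 = 10·(10ⁿ mod 4) enter the condition on the next
-- digit t, so a finite search decides it.  The table is opaque so that comparing lifted
-- approximations never unfolds its proof, the evaluation of the whole table.
opaque
  next-digit : ∀ {a} → a < 10 → ∀ {b} → b < 10 → ∀ {s} → s < 20 → ∀ {w} → w < 4 →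
               EndsIn1or3 s →
               ∃ λ t → t < 20 × (4 * a + 2 * s * t + 10 * w * (t * t)) % 40 ≡ (4 * b) % 40
  next-digit = from-yes
    (allUpTo? (λ a → allUpTo? (λ b → allUpTo? (λ s → allUpTo? (λ w →
       (s % 10 ≟ 1 ⊎-dec s % 10 ≟ 3) →-dec
       anyUpTo? (λ t → (4 * a + 2 * s * t + 10 * w * (t * t)) % 40 ≟ (4 * b) % 40) 20) 4) 20) 10) 10)

approx-lift : ∀ {u n s} → RootApprox u n s → ∃ λ t → RootApprox u (suc n) (s + 10 ^ suc n * t)
approx-lift {u} {n} {s} (≡-mod i j e , s≡1∨3)
  with next-digit (m%n<n j 10) (m%n<n i 10) (m%n<n s 20) (m%n<n (10 ^ n) 4)
                  (EndsIn1or3-resp (≡-mod-sym (≡-mod-∣ (divides 2 refl) (%-≡-mod s))) s≡1∨3)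
... | t , _ , t-ok =
  t , square-lift {s} {u} {i} {j} {P} {t} e′ digit-ok ,
  EndsIn1or3-resp {s} (≡-mod-sym s+P*t≡s) s≡1∨3
  where
  instance
    10^n≢0 : NonZero (10 ^ n)
    10^n≢0 = m^n≢0 10 n
  P = 10 ^ suc n
  e′ : s * s + i * (4 * P) ≡ u + j * (4 * P)
  e′ = subst (λ M → s * s + i * M ≡ u + j * M) (*-assoc 4 10 (10 ^ n)) e
  digit-ok : 4 * j + 2 * s * t + P * (t * t) ≡ 4 * i mod 40
  digit-ok = begin
    4 * j + 2 * s * t + P * (t * t)
      ≈⟨ +-cong-mod (+-cong-mod (*-scale-mod 4 (≡-mod-sym (%-≡-mod j)))
                                (*-congʳ-mod t (*-scale-mod 2 (≡-mod-sym (%-≡-mod s)))))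
                    (*-congʳ-mod (t * t) (*-scale-mod 10 (≡-mod-sym (%-≡-mod (10 ^ n))))) ⟩
    4 * (j % 10) + 2 * (s % 20) * t + 10 * (10 ^ n % 4) * (t * t)
      ≈⟨ %-≡⇒≡-mod t-ok ⟩
    4 * (i % 10)
      ≈⟨ *-scale-mod 4 (%-≡-mod i) ⟩
    4 * i  ∎
    where open ≡-mod-Reasoning 40
  s+P*t≡s : s + P * t ≡ s mod 10
  s+P*t≡s = ≡-mod-∣ (m∣m*n (10 ^ n)) (+-multiple-mod t)

approx-base : ∀ {u} → u % 40 ≡ 1 ⊎ u % 40 ≡ 9 → ∃ (RootApprox u 0)
approx-base (inj₁ u≡1) = 1 , %-≡⇒≡-mod (sym u≡1) , inj₁ refl
approx-base (inj₂ u≡9) = 3 , %-≡⇒≡-mod (sym u≡9) , inj₂ refl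

root-approx : ∀ {u} → u % 40 ≡ 1 ⊎ u % 40 ≡ 9 → ∀ n → ∃ (RootApprox u n)
root-approx u≡1∨9 zero = approx-base u≡1∨9
root-approx u≡1∨9 (suc n) =
  let s , approx = root-approx u≡1∨9 n
      t , approx′ = approx-lift {n = n} {s} approx
  in  s + 10 ^ suc n * t , approx′

criterion⇒10-adic-root : ∀ {q} → SquareCriterion q → Σ L λ a → SquareEq a q
criterion⇒10-adic-root {q} (k , l , u , q≡ , _ , u≡1∨9) =
  fromCoherent x x-coherent , fromCoherent-square x x-coherent x*x≡q
  where
  c = 2 ^ l * 5 ^ k
  s : ℕ → ℕ
  s n = proj₁ (root-approx u≡1∨9 n)
  x : ℕ → ℕ
  x n = c * s n
  x-coherent : ∀ n → x (suc n) ≡ x n mod 10 ^ n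
  x-coherent n = *-congˡ-mod c (≡-mod-∣ (n∣m*n 10) (+-multiple-mod _))
  c*c*u≡q : c * c * u ≡ q
  c*c*u≡q = trans (cong (_* u) ([m*n]*[o*p]≡[m*o]*[n*p] (2 ^ l) (5 ^ k) (2 ^ l) (5 ^ k)))
    (trans (cong₂ (λ a b → a * b * u) (sym (^-double 2 l)) (sym (^-double 5 k))) (sym q≡))
  x*x≡q : ∀ n → x n * x n ≡ q mod 10 ^ n
  x*x≡q n = begin
    c * s n * (c * s n)  ≡⟨ [m*n]*[o*p]≡[m*o]*[n*p] c (s n) c (s n) ⟩
    c * c * (s n * s n)  ≈⟨ *-congˡ-mod (c * c) (≡-mod-∣ (n∣m*n 40) s*s≡u) ⟩
    c * c * u            ≡⟨ c*c*u≡q ⟩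
    q                    ∎
    where
    open ≡-mod-Reasoning (10 ^ n)
    s*s≡u : s n * s n ≡ u mod 40 * 10 ^ n
    s*s≡u = proj₁ (proj₂ (root-approx u≡1∨9 n))

mainTheorem2 : (q : ℕ) → ¬ IsPerfectSquare q →
    ((Σ L λ a → SquareEq a q) ⇔
     (Σ ℕ λ k → Σ ℕ λ l → Σ ℕ λ q′ →
        (q ≡ 2 ^ (2 * l) * 5 ^ (2 * k) * q′) × (gcd q′ 10 ≡ 1) ×
        ((q′ % 40 ≡ 1) ⊎ (q′ % 40 ≡ 9))))
mainTheorem2 q ¬square = mk⇔
  (λ (a , sq) → square-mod-10^n⇒criterion q≢0 (SquareEq⇒square-mod-10^n {a} sq))
  criterion⇒10-adic-root
  where
  q≢0 : q ≢ 0
  q≢0 refl = ¬square (0 , refl)
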